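{- Let $a\ge 1$ and $k\ge 2$ be integers and let $T=T(a,a+1,\ldots,a+k)$ be the unit arithmetic starlike tree with arm lengths $a,a+1,\ldots,a+k$. If $T$ has an odd number of vertices, then $T$ is transmission irregular.
   Context: All graphs are finite, simple and connected; $d_G(u,v)$ is the shortest-path distance. The transmission of a vertex $v$ of $G$ is ${\rm Tr}_G(v)=\sum_{u\in V(G)} d_G(u,v)$. A graph is transmission irregular if all its vertices have pairwise different transmissions. For $t\ge 3$ and positive integers $k_1\le\cdots\le k_t$, the starlike tree $T(k_1,\ldots,k_t)$ is the tree obtained by attaching to a single vertex $t$ pendant paths of lengths $k_1,\ldots,k_t$ (called the arms). It is unit arithmetic if $k_{i+1}-k_i=1$ for all $i\in\{1,\ldots,t-1\}$. The order of $T(a,\ldots,a+k)$ is $(k+1)(a+\frac k2)+1$. -}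

module Defs where

open import Data.Nat using (ℕ; zero; suc; _+_; _≤_; _%_)
open import Data.Fin using (Fin; toℕ) renaming (zero to fzero; suc to fsuc)
open import Data.List using (List; _∷_; map; concatMap; length; allFin)
open import Data.Nat.ListAction using (sum)
open import Data.Product using (_×_; Σ; ∃)
open import Relation.Binary.PropositionalEquality using (_≡_)

-- Vertices of the starlike tree with t arms of lengths len i.
-- 'node i j' is the vertex at distance (toℕ j + 1) from the center on arm i.
data Vertex {t : ℕ} (len : Fin t → ℕ) : Set where
  center : Vertex len
  node   : (i : Fin t) → Fin (len i) → Vertex len

data Edge {t : ℕ} (len : Fin t → ℕ) : Vertex len → Vertex len → Set where
  hub  : (i : Fin t) (j : Fin (len i)) → toℕ j ≡ 0 → Edge len center (node i j)
  step : (i : Fin t) (j : Fin (len i)) (j' : Fin (len i)) →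
         toℕ j' ≡ suc (toℕ j) → Edge len (node i j) (node i j')

data Adj {t : ℕ} (len : Fin t → ℕ) (u v : Vertex len) : Set where
  fwd : Edge len u v → Adj len u v
  bwd : Edge len v u → Adj len u v

data Walk {t : ℕ} (len : Fin t → ℕ) : Vertex len → Vertex len → ℕ → Set where
  nil  : ∀ {v} → Walk len v v 0
  cons : ∀ {u w v n} → Adj len u w → Walk len w v n → Walk len u v (suc n)

IsDistance : {t : ℕ} (len : Fin t → ℕ) → (Vertex len → Vertex len → ℕ) → Set
IsDistance len d = ∀ u v → Walk len u v (d u v) × (∀ n → Walk len u v n → d u v ≤ n)

allVertices : {t : ℕ} (len : Fin t → ℕ) → List (Vertex len)
allVertices {t} len = center ∷ concatMap (λ i → map (node i) (allFin (len i))) (allFin t)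

order : {t : ℕ} (len : Fin t → ℕ) → ℕ
order len = length (allVertices len)

Tr : {t : ℕ} (len : Fin t → ℕ) → (Vertex len → Vertex len → ℕ) → Vertex len → ℕ
Tr len d v = sum (map (λ u → d u v) (allVertices len))

TransmissionIrregular : {t : ℕ} (len : Fin t → ℕ) → (Vertex len → Vertex len → ℕ) → Set
TransmissionIrregular len d = ∀ u v → Tr len d u ≡ Tr len d v → u ≡ v

unitArith : (a k : ℕ) → Fin (suc k) → ℕ
unitArith a k i = a + toℕ i

module Submission where

-- The explicit function 'dist' (|j − j'| on a common arm, sum of the
-- depths otherwise) is realised by a walk and changes by at most one along an edge,
-- so it is the shortest-path distance and every IsDistance function equals it.
-- Writing 'shared u v' for the length of the common part of the paths from the
-- centre to u and to v, dist u v + 2·shared u v = depth u + depth v; summing over u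
-- gives Tr(centre) = S and, for a vertex at depth x on an arm of length L in a tree of
-- order 2m + 1 with c + L = m,  Tr = S + x(x + 2c)  (S is the sum of all depths).
--
-- For T(a, …, a+k) the order equation reads 4m + (k+1) = (k+1)(2a + k + 1), so every
-- arm has a slack c_i = m − (a + i).  The centre has the least transmission, and
-- x ↦ x(x + 2c) is injective, which separates vertices on one arm.  Two vertices on
-- arms i < i + δ with equal transmission give x(x + 2(c + δ)) = y(y + 2c); parity
-- forces y = x + 2s with s ≥ 1 and then δx = 2s(x + s + c) ≥ 2(x + 1 + c), which the
-- order equation rules out since x ≤ a + i.

open import Defs
open import Data.Nat using (ℕ; suc; _≤_; _%_)
open import Data.Product using (_×_; ∃)
open import Relation.Binary.PropositionalEquality using (_≡_)

open import Data.Nat using (zero; _+_; _*_; _∸_; _<_; _⊓_; ∣_-_∣; z≤n; s≤s; _/_)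
open import Data.Nat.Properties
open import Data.Nat.DivMod using (m≡m%n+[m/n]*n)
open import Data.Nat.Divisibility using (_∣_; ∣m+n∣m⇒∣n; m∣m*n)
open import Data.Nat.Primality using (euclidsLemma; prime[2])
open import Data.Nat.Tactic.RingSolver using (solve-∀)
open import Data.Nat.ListAction using (sum)
open import Data.Nat.ListAction.Properties using (sum-++)
open import Data.Fin as Fin using (Fin; toℕ; fromℕ<)
open import Data.Fin.Properties using (toℕ-injective; toℕ<n; toℕ≤pred[n]; toℕ-fromℕ<)
  renaming (suc-injective to fsuc-injective)
open import Function using (_∘_)
open import Data.List using (List; []; _∷_; _++_; map; tabulate; length; concatMap; allFin)
open import Data.List.Properties using (map-cong; map-++; map-tabulate; tabulate-cong)
open import Algebra.Properties.CommutativeSemigroup +-commutativeSemigroup using (interchange)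
open import Data.Product using (_,_; proj₁; proj₂)
open import Data.Sum using (inj₁; inj₂; reduce)
open import Relation.Nullary using (yes; no; contradiction)
open import Relation.Binary.PropositionalEquality
  using (_≢_; refl; sym; trans; cong; cong₂; subst; subst₂; module ≡-Reasoning)
open import Relation.Binary.Definitions using (tri<; tri≈; tri>)

-- Arithmetic of the transmission excess x(x + 2c)

-- Transmission of a vertex at depth x minus that of the centre (see Tr-node).
excess : ℕ → ℕ → ℕ
excess c x = x * (x + 2 * c)

excess-mono-≤ : ∀ c {x y} → x ≤ y → excess c x ≤ excess c y
excess-mono-≤ c x≤y = *-mono-≤ x≤y (+-monoˡ-≤ (2 * c) x≤y)

excess-mono-< : ∀ c {x y} → x < y → excess c x < excess c y
excess-mono-< c x<y = *-mono-< x<y (+-monoˡ-< (2 * c) x<y)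

excess-slack-< : ∀ x {c c'} → c < c' → excess c (suc x) < excess c' (suc x)
excess-slack-< x c<c' = *-monoʳ-< (suc x) (+-monoʳ-< (suc x) (*-monoʳ-< 2 c<c'))

excess-injective : ∀ c {x y} → excess c x ≡ excess c y → x ≡ y
excess-injective c {x} {y} eq with <-cmp x y
... | tri< x<y _ _ = contradiction eq (<⇒≢ (excess-mono-< c x<y))
... | tri≈ _ x≡y _ = x≡y
... | tri> _ _ y<x = contradiction (sym eq) (<⇒≢ (excess-mono-< c y<x))

-- The equation excess (c + δ) x = excess c (x + r), with the common part x² + 2cx cancelled.
excess-gap : ∀ c δ x r → excess (c + δ) x ≡ excess c (x + r) →
             2 * (δ * x) ≡ 2 * (r * x + c * r) + r * r
excess-gap c δ x r eq = +-cancelˡ-≡ (x * x + 2 * c * x) _ _ (begin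
  x * x + 2 * c * x + 2 * (δ * x)           ≡⟨ lhs c δ x ⟩
  excess (c + δ) x                          ≡⟨ eq ⟩
  excess c (x + r)                          ≡⟨ rhs c x r ⟩
  x * x + 2 * c * x + (2 * (r * x + c * r) + r * r) ∎)
  where
  open ≡-Reasoning
  lhs : ∀ c δ x → x * x + 2 * c * x + 2 * (δ * x) ≡ x * (x + 2 * (c + δ))
  lhs = solve-∀
  rhs : ∀ c x r → (x + r) * (x + r + 2 * c) ≡ x * x + 2 * c * x + (2 * (r * x + c * r) + r * r)
  rhs = solve-∀

even-square : ∀ r → 2 ∣ r * r → 2 ∣ r
even-square r 2∣r² = reduce (euclidsLemma r r prime[2] 2∣r²)

-- Core of the cross-arm case: excess (c + δ) x = excess c y with δ, x ≥ 1 forces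
-- y = x + 2s with s ≥ 1, and then δx = 2s(x + s + c) ≥ 2(x + 1 + c).
excess-cross : ∀ c δ x y → excess (c + suc δ) (suc x) ≡ excess c y →
               2 * (suc x + 1 + c) ≤ suc δ * suc x
excess-cross c δ x y eq = bound s (*-cancelˡ-≡ _ _ 2 halved)
  where
  open ≡-Reasoning
  x' = suc x
  x'<y : x' < y
  x'<y = ≰⇒> λ y≤x' → <-irrefl (sym eq)
    (≤-<-trans (excess-mono-≤ c y≤x') (excess-slack-< x (m<m+n c (s≤s z≤n))))
  difference : ∃ λ r → x' + r ≡ y
  difference = m≤n⇒∃[o]m+o≡n (<⇒≤ x'<y)
  r : ℕ
  r = proj₁ difference
  gap : 2 * (suc δ * x') ≡ 2 * (r * x' + c * r) + r * r
  gap = excess-gap c (suc δ) x' r (trans eq (cong (excess c) (sym (proj₂ difference))))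
  r-even : 2 ∣ r
  r-even = even-square r
    (∣m+n∣m⇒∣n (subst (2 ∣_) gap (m∣m*n (suc δ * x'))) (m∣m*n (r * x' + c * r)))
  s : ℕ
  s = _∣_.quotient r-even
  halved : 2 * (suc δ * x') ≡ 2 * (2 * s * (x' + s + c))
  halved = begin
    2 * (suc δ * x')                      ≡⟨ gap ⟩
    2 * (r * x' + c * r) + r * r          ≡⟨ cong (λ z → 2 * (z * x' + c * z) + z * z)
                                               (_∣_.equality r-even) ⟩
    2 * (s * 2 * x' + c * (s * 2)) + s * 2 * (s * 2) ≡⟨ factor s x' c ⟩
    2 * (2 * s * (x' + s + c))            ∎
    where
    factor : ∀ s x c → 2 * (s * 2 * x + c * (s * 2)) + s * 2 * (s * 2) ≡ 2 * (2 * s * (x + s + c))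
    factor = solve-∀
  bound : ∀ s → suc δ * x' ≡ 2 * s * (x' + s + c) → 2 * (x' + 1 + c) ≤ suc δ * x'
  bound zero ()
  bound (suc s) δx≡ = subst (2 * (x' + 1 + c) ≤_) (sym δx≡)
    (*-mono-≤ (m≤m*n 2 (suc s)) (+-monoˡ-≤ c (+-monoʳ-≤ x' (s≤s z≤n))))

x<2[x+1+c] : ∀ x c → x < 2 * (x + 1 + c)
x<2[x+1+c] x c = <-≤-trans (m<m+n x (s≤s z≤n)) (≤-trans (m≤m+n (x + 1) c) (m≤n*m _ 2))

-- Consequence in the form used against the order equation: beyond 2x, the left-hand
-- side δx must grow by at least 2 + 2c, so in particular δ ≥ 2.
excess-cross-growth : ∀ c δ x → 2 * (x + 1 + c) ≤ δ * x → 2 + 2 * c ≤ (δ ∸ 2) * x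
excess-cross-growth c zero x le = contradiction (≤-trans le z≤n) (<⇒≱ (x<2[x+1+c] x c))
excess-cross-growth c (suc zero) x le =
  contradiction (≤-trans le (≤-reflexive (*-identityˡ x))) (<⇒≱ (x<2[x+1+c] x c))
excess-cross-growth c (suc (suc g)) x le =
  +-cancelˡ-≤ (2 * x) _ _ (subst₂ _≤_ (split-left x c) (split-right g x) le)
  where
  split-left : ∀ x c → 2 * (x + 1 + c) ≡ 2 * x + (2 + 2 * c)
  split-left = solve-∀
  split-right : ∀ g x → suc (suc g) * x ≡ 2 * x + g * x
  split-right = solve-∀

-- The order equation of T(a, …, a+k)

-- Written with K = k + 1, the order 2m + 1 of T(a, …, a+k) satisfies
-- 4m + K = K(2a + K) (see order-equation).  With a ≥ 1 and k ≥ 2 this leaves room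
-- for a nonnegative slack m − (a + i) on every arm.
longest-arm-≤-half : ∀ a k m → 1 ≤ a → 2 ≤ k →
  2 * (2 * m) + suc k ≡ suc k * (2 * a + suc k) → a + k ≤ m
longest-arm-≤-half (suc b) (suc zero) m _ (s≤s ()) order
longest-arm-≤-half (suc b) (suc (suc f)) m _ _ order =
  *-cancelˡ-≤ 2 (*-cancelˡ-≤ 2 (subst (2 * (2 * (suc b + suc (suc f))) ≤_) (sym 4m≡) (m≤m+n _ _)))
  where
  expand : ∀ b f → suc (2 + f) * (2 * suc b + suc (2 + f))
    ≡ (2 * (2 * (suc b + (2 + f))) + (2 * b + 3 * f + 2 * f * b + f * f)) + suc (2 + f)
  expand = solve-∀
  4m≡ : 2 * (2 * m) ≡ 2 * (2 * (suc b + suc (suc f))) + (2 * b + 3 * f + 2 * f * b + f * f)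
  4m≡ = +-cancelʳ-≡ (suc (2 + f)) _ _ (trans order (expand b f))

-- The order equation bounds what arms i < i + δ ≤ k can absorb: with slack
-- c = m − (a + i + δ) of the longer arm, (δ − 2)(a + i) < 2 + 2c.  Contrast with
-- excess-cross-growth, which equal transmissions would force.
cross-arm-budget : ∀ a k m i δ c → 2 * (2 * m) + suc k ≡ suc k * (2 * a + suc k) →
  c + (a + i + δ) ≡ m → i + δ ≤ k → (δ ∸ 2) * (a + i) < 2 + 2 * c
cross-arm-budget a k m i zero c _ _ _ = s≤s z≤n
cross-arm-budget a k m i (suc zero) c _ _ _ = s≤s z≤n
cross-arm-budget a k m i (suc (suc g)) c order refl i+δ≤k
  with m≤n⇒∃[o]m+o≡n i+δ≤k
... | e , refl = *-cancelˡ-≤ 2 (subst (2 * suc (g * (a + i)) ≤_) (sym doubled) (m≤m+n _ _))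
  where
  K = suc (i + suc (suc g) + e)
  R = 4 * (a + i + suc (suc g)) + K
  Z = 2 * i * a + 2 * e * a + 2 * a + i * i + g * g + e * e + 2 * i * e + 2 * g * e + i + g + 5 * e
  expandˡ : ∀ a i g e c → 2 * (2 * (c + (a + i + suc (suc g)))) + suc (i + suc (suc g) + e) + 4
    ≡ 2 * (2 + 2 * c) + (4 * (a + i + suc (suc g)) + suc (i + suc (suc g) + e))
  expandˡ = solve-∀
  expandʳ : ∀ a i g e → suc (i + suc (suc g) + e) * (2 * a + suc (i + suc (suc g) + e)) + 4
    ≡ (2 * suc (g * (a + i))
       + (2 * i * a + 2 * e * a + 2 * a + i * i + g * g + e * e + 2 * i * e + 2 * g * e + i + g + 5 * e))
      + (4 * (a + i + suc (suc g)) + suc (i + suc (suc g) + e))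
  expandʳ = solve-∀
  -- 2(2 + 2c) exceeds 2g(a + i) by 2 + Z, Z being a sum of nonnegative monomials.
  doubled : 2 * (2 + 2 * c) ≡ 2 * suc (g * (a + i)) + Z
  doubled = +-cancelʳ-≡ R _ _ (trans (sym (expandˡ a i g e c)) (trans (cong (_+ 4) order) (expandʳ a i g e)))

-- Finite sums

sum-map-+ : ∀ {A : Set} (f g : A → ℕ) (xs : List A) →
  sum (map (λ x → f x + g x) xs) ≡ sum (map f xs) + sum (map g xs)
sum-map-+ f g [] = refl
sum-map-+ f g (x ∷ xs) =
  trans (cong (f x + g x +_) (sum-map-+ f g xs)) (interchange (f x) (g x) _ _)

sum-map-const : ∀ {A : Set} (c : ℕ) (xs : List A) → sum (map (λ _ → c) xs) ≡ length xs * c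
sum-map-const c [] = refl
sum-map-const c (x ∷ xs) = cong (c +_) (sum-map-const c xs)

sum-map-*ˡ : ∀ {A : Set} (c : ℕ) (f : A → ℕ) (xs : List A) →
  sum (map (λ x → c * f x) xs) ≡ c * sum (map f xs)
sum-map-*ˡ c f [] = sym (*-zeroʳ c)
sum-map-*ˡ c f (x ∷ xs) =
  trans (cong (c * f x +_) (sum-map-*ˡ c f xs)) (sym (*-distribˡ-+ c (f x) _))

sum-map-concatMap : ∀ {A B : Set} (g : B → ℕ) (h : A → List B) (xs : List A) →
  sum (map g (concatMap h xs)) ≡ sum (map (λ x → sum (map g (h x))) xs)
sum-map-concatMap g h [] = refl
sum-map-concatMap g h (x ∷ xs) = begin
  sum (map g (h x ++ concatMap h xs))
    ≡⟨ cong sum (map-++ g (h x) (concatMap h xs)) ⟩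
  sum (map g (h x) ++ map g (concatMap h xs))
    ≡⟨ sum-++ (map g (h x)) _ ⟩
  sum (map g (h x)) + sum (map g (concatMap h xs))
    ≡⟨ cong (sum (map g (h x)) +_) (sum-map-concatMap g h xs) ⟩
  sum (map g (h x)) + sum (map (λ x → sum (map g (h x))) xs) ∎
  where open ≡-Reasoning

sum-tabulate-zero : ∀ {n} (f : Fin n → ℕ) → (∀ i → f i ≡ 0) → sum (tabulate f) ≡ 0
sum-tabulate-zero {zero} f f≡0 = refl
sum-tabulate-zero {suc n} f f≡0 =
  cong₂ _+_ (f≡0 Fin.zero) (sum-tabulate-zero (f ∘ Fin.suc) (f≡0 ∘ Fin.suc))

sum-tabulate-single : ∀ {n} (f : Fin n → ℕ) (i : Fin n) → (∀ i' → i' ≢ i → f i' ≡ 0) →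
  sum (tabulate f) ≡ f i
sum-tabulate-single {suc n} f Fin.zero f≡0 =
  trans (cong (f Fin.zero +_) (sum-tabulate-zero (f ∘ Fin.suc) (λ i' → f≡0 (Fin.suc i') λ ())))
        (+-identityʳ _)
sum-tabulate-single {suc n} f (Fin.suc i) f≡0 =
  cong₂ _+_ (f≡0 Fin.zero λ ())
            (sum-tabulate-single (f ∘ Fin.suc) i (λ i' i'≢i → f≡0 (Fin.suc i') (i'≢i ∘ fsuc-injective)))

rangeSum : ℕ → (ℕ → ℕ) → ℕ
rangeSum zero h = 0
rangeSum (suc n) h = h 0 + rangeSum n (h ∘ suc)

sum-tabulate-toℕ : ∀ n (h : ℕ → ℕ) → sum (tabulate {n = n} (h ∘ toℕ)) ≡ rangeSum n h
sum-tabulate-toℕ zero h = refl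
sum-tabulate-toℕ (suc n) h = cong (h 0 +_) (sum-tabulate-toℕ n (h ∘ suc))

rangeSum-cong : ∀ n {f g : ℕ → ℕ} → (∀ y → y < n → f y ≡ g y) → rangeSum n f ≡ rangeSum n g
rangeSum-cong zero f≡g = refl
rangeSum-cong (suc n) f≡g =
  cong₂ _+_ (f≡g 0 (s≤s z≤n)) (rangeSum-cong n (λ y y<n → f≡g (suc y) (s≤s y<n)))

rangeSum-++ : ∀ m n h → rangeSum (m + n) h ≡ rangeSum m h + rangeSum n (λ y → h (m + y))
rangeSum-++ zero n h = refl
rangeSum-++ (suc m) n h =
  trans (cong (h 0 +_) (rangeSum-++ m n (h ∘ suc))) (sym (+-assoc (h 0) _ _))

rangeSum-const : ∀ n c → rangeSum n (λ _ → c) ≡ n * c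
rangeSum-const zero c = refl
rangeSum-const (suc n) c = cong (c +_) (rangeSum-const n c)

rangeSum-arith : ∀ a n → 2 * rangeSum n (λ y → a + y) + n ≡ n * (2 * a + n)
rangeSum-arith a zero = refl
rangeSum-arith a (suc n) = begin
  2 * (a + 0 + rangeSum n (λ y → a + suc y)) + suc n
    ≡⟨ cong (λ z → 2 * (a + 0 + z) + suc n) (rangeSum-cong n (λ y _ → +-suc a y)) ⟩
  2 * (a + 0 + rangeSum n (λ y → suc a + y)) + suc n
    ≡⟨ regroup a n _ ⟩
  (2 * rangeSum n (λ y → suc a + y) + n) + (2 * a + 1)
    ≡⟨ cong (_+ (2 * a + 1)) (rangeSum-arith (suc a) n) ⟩
  n * (2 * suc a + n) + (2 * a + 1)
    ≡⟨ expand a n ⟩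
  suc n * (2 * a + suc n) ∎
  where
  open ≡-Reasoning
  regroup : ∀ a n R → 2 * (a + 0 + R) + suc n ≡ (2 * R + n) + (2 * a + 1)
  regroup = solve-∀
  expand : ∀ a n → n * (2 * suc a + n) + (2 * a + 1) ≡ suc n * (2 * a + suc n)
  expand = solve-∀

-- The overlaps of a vertex at depth x with all vertices of its arm (length L ≥ x):
-- 2 Σ_{y<L} min(y + 1, x) + x² = x(2L + 1).
rangeSum-shared : ∀ {x L} → x ≤ L → 2 * rangeSum L (λ y → suc y ⊓ x) + x * x ≡ x * (2 * L + 1)
rangeSum-shared {x} x≤L with m≤n⇒∃[o]m+o≡n x≤L
... | e , refl = +-cancelʳ-≡ x _ _ (begin
  2 * rangeSum (x + e) h + x * x + x
    ≡⟨ cong (λ z → 2 * z + x * x + x) (rangeSum-++ x e h) ⟩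
  2 * (rangeSum x h + rangeSum e (λ y → h (x + y))) + x * x + x
    ≡⟨ cong₂ (λ p q → 2 * (p + q) + x * x + x)
             (rangeSum-cong x (λ _ → m≤n⇒m⊓n≡m))
             (trans (rangeSum-cong e (λ y _ → m≥n⇒m⊓n≡n (m≤n⇒m≤1+n (m≤m+n x y)))) (rangeSum-const e x)) ⟩
  2 * (rangeSum x suc + e * x) + x * x + x
    ≡⟨ regroup (rangeSum x suc) e x ⟩
  (2 * rangeSum x suc + x) + (2 * (e * x) + x * x)
    ≡⟨ cong (_+ (2 * (e * x) + x * x)) (rangeSum-arith 1 x) ⟩
  x * (2 * 1 + x) + (2 * (e * x) + x * x)
    ≡⟨ expand e x ⟩
  x * (2 * (x + e) + 1) + x ∎)
  where
  open ≡-Reasoning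
  h : ℕ → ℕ
  h y = suc y ⊓ x
  regroup : ∀ R e x → 2 * (R + e * x) + x * x + x ≡ (2 * R + x) + (2 * (e * x) + x * x)
  regroup = solve-∀
  expand : ∀ e x → x * (2 * 1 + x) + (2 * (e * x) + x * x) ≡ x * (2 * (x + e) + 1) + x
  expand = solve-∀

-- Absolute differences

∣p-q∣≤1+∣1+p-q∣ : ∀ p q → ∣ p - q ∣ ≤ suc ∣ suc p - q ∣
∣p-q∣≤1+∣1+p-q∣ zero zero = z≤n
∣p-q∣≤1+∣1+p-q∣ zero (suc q) = ≤-refl
∣p-q∣≤1+∣1+p-q∣ (suc p) zero = m≤n⇒m≤1+n (n≤1+n _)
∣p-q∣≤1+∣1+p-q∣ (suc p) (suc q) = ∣p-q∣≤1+∣1+p-q∣ p q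

∣1+p-q∣≤1+∣p-q∣ : ∀ p q → ∣ suc p - q ∣ ≤ suc ∣ p - q ∣
∣1+p-q∣≤1+∣p-q∣ zero zero = ≤-refl
∣1+p-q∣≤1+∣p-q∣ zero (suc q) = m≤n⇒m≤1+n (n≤1+n _)
∣1+p-q∣≤1+∣p-q∣ (suc p) zero = ≤-refl
∣1+p-q∣≤1+∣p-q∣ (suc p) (suc q) = ∣1+p-q∣≤1+∣p-q∣ p q

∣p-q∣+2[p⊓q]≡p+q : ∀ p q → ∣ p - q ∣ + 2 * (p ⊓ q) ≡ p + q
∣p-q∣+2[p⊓q]≡p+q zero q = +-identityʳ q
∣p-q∣+2[p⊓q]≡p+q (suc p) zero = refl
∣p-q∣+2[p⊓q]≡p+q (suc p) (suc q) = begin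
  ∣ p - q ∣ + 2 * suc (p ⊓ q)      ≡⟨ shift ∣ p - q ∣ (p ⊓ q) ⟩
  suc (suc (∣ p - q ∣ + 2 * (p ⊓ q))) ≡⟨ cong (suc ∘ suc) (∣p-q∣+2[p⊓q]≡p+q p q) ⟩
  suc (suc (p + q))                ≡⟨ cong suc (sym (+-suc p q)) ⟩
  suc p + suc q                    ∎
  where
  open ≡-Reasoning
  shift : ∀ d m → d + 2 * suc m ≡ suc (suc (d + 2 * m))
  shift = solve-∀

-- Distances and transmissions in an arbitrary starlike tree

module StarlikeTree {t : ℕ} (len : Fin t → ℕ) where

  V : Set
  V = Vertex len

  depth : V → ℕ
  depth center = 0
  depth (node i j) = suc (toℕ j)

  dist : V → V → ℕ
  dist center v = depth v
  dist (node i j) center = suc (toℕ j)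
  dist (node i j) (node i' j') with i Fin.≟ i'
  ... | yes _ = ∣ toℕ j - toℕ j' ∣
  ... | no _ = suc (toℕ j) + suc (toℕ j')

  -- Number of edges shared by the paths from the centre to u and to v.
  shared : V → V → ℕ
  shared center v = 0
  shared (node i j) center = 0
  shared (node i j) (node i' j') with i Fin.≟ i'
  ... | yes _ = suc (toℕ j) ⊓ suc (toℕ j')
  ... | no _ = 0

  adj-sym : ∀ {u v} → Adj len u v → Adj len v u
  adj-sym (fwd e) = bwd e
  adj-sym (bwd e) = fwd e

  _▷_ : ∀ {u w v n} → Walk len u w n → Adj len w v → Walk len u v (suc n)
  nil ▷ e = cons e nil
  cons e' p ▷ e = cons e' (p ▷ e)

  reverse : ∀ {u v n} → Walk len u v n → Walk len v u n
  reverse nil = nil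
  reverse (cons e p) = reverse p ▷ adj-sym e

  _++ᵂ_ : ∀ {u w v m n} → Walk len u w m → Walk len w v n → Walk len u v (m + n)
  nil ++ᵂ q = q
  cons e p ++ᵂ q = cons e (p ++ᵂ q)

  climb : ∀ e i (j j' : Fin (len i)) → toℕ j' ≡ e + toℕ j → Walk len (node i j) (node i j') e
  climb zero i j j' eq = subst (λ z → Walk len (node i j) (node i z) 0) (toℕ-injective (sym eq)) nil
  climb (suc e) i j j' eq =
    cons (fwd (step i j j₁ (toℕ-fromℕ< j₁<len))) (climb e i j₁ j' j'≡)
    where
    j₁<len : suc (toℕ j) < len i
    j₁<len = ≤-<-trans (subst (suc (toℕ j) ≤_) (sym eq) (s≤s (m≤n+m (toℕ j) e))) (toℕ<n j')
    j₁ : Fin (len i)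
    j₁ = fromℕ< j₁<len
    j'≡ : toℕ j' ≡ e + toℕ j₁
    j'≡ = trans eq (trans (sym (+-suc e (toℕ j))) (cong (e +_) (sym (toℕ-fromℕ< j₁<len))))

  fromCenter : ∀ i (j : Fin (len i)) → Walk len center (node i j) (suc (toℕ j))
  fromCenter i j = cons (fwd (hub i j₀ (toℕ-fromℕ< 0<len))) (climb (toℕ j) i j₀ j j≡)
    where
    0<len : 0 < len i
    0<len = ≤-<-trans z≤n (toℕ<n j)
    j₀ : Fin (len i)
    j₀ = fromℕ< 0<len
    j≡ : toℕ j ≡ toℕ j + toℕ j₀
    j≡ = sym (trans (cong (toℕ j +_) (toℕ-fromℕ< 0<len)) (+-identityʳ (toℕ j)))

  dist-walk : ∀ u v → Walk len u v (dist u v)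
  dist-walk center center = nil
  dist-walk center (node i j) = fromCenter i j
  dist-walk (node i j) center = reverse (fromCenter i j)
  dist-walk (node i j) (node i' j') with i Fin.≟ i'
  ... | no _ = reverse (fromCenter i j) ++ᵂ fromCenter i' j'
  ... | yes refl with ≤-total (toℕ j) (toℕ j')
  ...   | inj₁ j≤j' = subst (Walk len (node i j) (node i j')) (sym (m≤n⇒∣m-n∣≡n∸m j≤j'))
                        (climb _ i j j' (sym (m∸n+n≡m j≤j')))
  ...   | inj₂ j'≤j = subst (Walk len (node i j) (node i j')) (sym (m≤n⇒∣n-m∣≡n∸m j'≤j))
                        (reverse (climb _ i j' j (sym (m∸n+n≡m j'≤j))))

  dist-adj : ∀ {u w} v → Adj len u w → dist u v ≤ suc (dist w v)
  dist-adj center (fwd (hub i j j≡0)) = z≤n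
  dist-adj (node i' j') (fwd (hub i j j≡0)) with i Fin.≟ i'
  ... | yes refl rewrite j≡0 = ≤-refl
  ... | no _ = s≤s (≤-trans (n≤1+n _) (m≤n+m (suc (toℕ j')) (suc (toℕ j))))
  dist-adj center (bwd (hub i j j≡0)) rewrite j≡0 = ≤-refl
  dist-adj (node i' j') (bwd (hub i j j≡0)) with i Fin.≟ i'
  ... | yes refl rewrite j≡0 = m≤n⇒m≤1+n (n≤1+n _)
  ... | no _ rewrite j≡0 = ≤-refl
  dist-adj center (fwd (step i j j' j'≡)) rewrite j'≡ = s≤s (m≤n⇒m≤1+n (n≤1+n _))
  dist-adj (node i'' j'') (fwd (step i j j' j'≡)) with i Fin.≟ i''
  ... | yes refl rewrite j'≡ = ∣p-q∣≤1+∣1+p-q∣ (toℕ j) (toℕ j'')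
  ... | no _ rewrite j'≡ = m≤n⇒m≤1+n (n≤1+n _)
  dist-adj center (bwd (step i j j' j'≡)) rewrite j'≡ = ≤-refl
  dist-adj (node i'' j'') (bwd (step i j j' j'≡)) with i Fin.≟ i''
  ... | yes refl rewrite j'≡ = ∣1+p-q∣≤1+∣p-q∣ (toℕ j) (toℕ j'')
  ... | no _ rewrite j'≡ = ≤-refl

  dist-refl : ∀ v → dist v v ≡ 0
  dist-refl center = refl
  dist-refl (node i j) with i Fin.≟ i
  ... | yes _ = ∣n-n∣≡0 (toℕ j)
  ... | no i≢i = contradiction refl i≢i

  dist-minimal : ∀ {u} v n → Walk len u v n → dist u v ≤ n
  dist-minimal v zero nil = ≤-reflexive (dist-refl v)
  dist-minimal v (suc n) (cons e p) = ≤-trans (dist-adj v e) (s≤s (dist-minimal v n p))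

  dist-isDistance : IsDistance len dist
  dist-isDistance u v = dist-walk u v , dist-minimal v

  irregular-for-any-distance : TransmissionIrregular len dist →
    ∀ d → IsDistance len d → TransmissionIrregular len d
  irregular-for-any-distance irregular d isDist u v eq =
    irregular u v (trans (sym (Tr≡ u)) (trans eq (Tr≡ v)))
    where
    d≡dist : ∀ u v → d u v ≡ dist u v
    d≡dist u v = ≤-antisym (proj₂ (isDist u v) (dist u v) (dist-walk u v))
                           (dist-minimal v (d u v) (proj₁ (isDist u v)))
    Tr≡ : ∀ v → Tr len d v ≡ Tr len dist v
    Tr≡ v = cong sum (map-cong (λ u → d≡dist u v) (allVertices len))

  vertices : List V
  vertices = allVertices len

  depthSum : ℕ
  depthSum = sum (map depth vertices)

  Shared : V → ℕ
  Shared v = sum (map (λ u → shared u v) vertices)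

  dist+shared : ∀ u v → dist u v + 2 * shared u v ≡ depth u + depth v
  dist+shared center v = +-identityʳ _
  dist+shared (node i j) center = refl
  dist+shared (node i j) (node i' j') with i Fin.≟ i'
  ... | yes _ = ∣p-q∣+2[p⊓q]≡p+q (suc (toℕ j)) (suc (toℕ j'))
  ... | no _ = +-identityʳ _

  Tr+Shared : ∀ v → Tr len dist v + 2 * Shared v ≡ depthSum + order len * depth v
  Tr+Shared v = begin
    Tr len dist v + 2 * Shared v
      ≡⟨ cong (Tr len dist v +_) (sym (sum-map-*ˡ 2 (λ u → shared u v) vertices)) ⟩
    sum (map (λ u → dist u v) vertices) + sum (map (λ u → 2 * shared u v) vertices)
      ≡⟨ sym (sum-map-+ (λ u → dist u v) (λ u → 2 * shared u v) vertices) ⟩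
    sum (map (λ u → dist u v + 2 * shared u v) vertices)
      ≡⟨ cong sum (map-cong (λ u → dist+shared u v) vertices) ⟩
    sum (map (λ u → depth u + depth v) vertices)
      ≡⟨ sum-map-+ depth (λ _ → depth v) vertices ⟩
    depthSum + sum (map (λ _ → depth v) vertices)
      ≡⟨ cong (depthSum +_) (sum-map-const (depth v) vertices) ⟩
    depthSum + order len * depth v ∎
    where open ≡-Reasoning

  sum-vertices : ∀ (g : V → ℕ) →
    sum (map g vertices) ≡ g center + sum (tabulate (λ i → sum (tabulate (λ j → g (node i j)))))
  sum-vertices g = cong (g center +_) (begin
    sum (map g (concatMap arm (allFin t)))
      ≡⟨ sum-map-concatMap g arm (allFin t) ⟩
    sum (map (λ i → sum (map g (arm i))) (tabulate (λ i → i)))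
      ≡⟨ cong sum (map-tabulate (λ i → i) (λ i → sum (map g (arm i)))) ⟩
    sum (tabulate (λ i → sum (map g (arm i))))
      ≡⟨ cong sum (tabulate-cong (λ i → cong sum (arm-values i))) ⟩
    sum (tabulate (λ i → sum (tabulate (λ j → g (node i j))))) ∎)
    where
    open ≡-Reasoning
    arm : Fin t → List V
    arm i = map (node i) (allFin (len i))
    arm-values : ∀ i → map g (arm i) ≡ tabulate (λ j → g (node i j))
    arm-values i = trans (cong (map g) (map-tabulate (λ j → j) (node i))) (map-tabulate (node i) g)

  order-arms : order len ≡ suc (sum (tabulate len))
  order-arms = begin
    length vertices                     ≡⟨ sym (*-identityʳ _) ⟩
    length vertices * 1                 ≡⟨ sym (sum-map-const 1 vertices) ⟩
    sum (map (λ _ → 1) vertices)        ≡⟨ sum-vertices (λ _ → 1) ⟩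
    suc (sum (tabulate (λ i → sum (tabulate {n = len i} (λ _ → 1)))))
      ≡⟨ cong (suc ∘ sum) (tabulate-cong arm-size) ⟩
    suc (sum (tabulate len))            ∎
    where
    open ≡-Reasoning
    arm-size : ∀ i → sum (tabulate {n = len i} (λ _ → 1)) ≡ len i
    arm-size i = trans (sum-tabulate-toℕ (len i) (λ _ → 1))
                       (trans (rangeSum-const (len i) 1) (*-identityʳ (len i)))

  -- Only the vertices of its own arm share edges with node i j.
  Shared-node : ∀ i j → 2 * Shared (node i j) + suc (toℕ j) * suc (toℕ j) ≡ suc (toℕ j) * (2 * len i + 1)
  Shared-node i j = trans (cong (λ z → 2 * z + x * x) Shared≡) (rangeSum-shared (toℕ<n j))
    where
    x = suc (toℕ j)
    other-arm : ∀ i' j' → i' ≢ i → shared (node i' j') (node i j) ≡ 0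
    other-arm i' j' i'≢i with i' Fin.≟ i
    ... | yes i'≡i = contradiction i'≡i i'≢i
    ... | no _ = refl
    same-arm : ∀ j' → shared (node i j') (node i j) ≡ suc (toℕ j') ⊓ x
    same-arm j' with i Fin.≟ i
    ... | yes _ = refl
    ... | no i≢i = contradiction refl i≢i
    Shared≡ : Shared (node i j) ≡ rangeSum (len i) (λ y → suc y ⊓ x)
    Shared≡ = begin
      Shared (node i j)
        ≡⟨ sum-vertices (λ u → shared u (node i j)) ⟩
      sum (tabulate (λ i' → sum (tabulate (λ j' → shared (node i' j') (node i j)))))
        ≡⟨ sum-tabulate-single _ i (λ i' i'≢i → sum-tabulate-zero _ (λ j' → other-arm i' j' i'≢i)) ⟩
      sum (tabulate (λ j' → shared (node i j') (node i j)))
        ≡⟨ cong sum (tabulate-cong same-arm) ⟩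
      sum (tabulate {n = len i} (λ j' → suc (toℕ j') ⊓ x))
        ≡⟨ sum-tabulate-toℕ (len i) (λ y → suc y ⊓ x) ⟩
      rangeSum (len i) (λ y → suc y ⊓ x) ∎
      where open ≡-Reasoning

  Tr-center : Tr len dist center ≡ depthSum
  Tr-center = cong sum (map-cong dist-to-center vertices)
    where
    dist-to-center : ∀ u → dist u center ≡ depth u
    dist-to-center center = refl
    dist-to-center (node i j) = refl

  Tr-node : ∀ {m c} i j → order len ≡ suc (2 * m) → c + len i ≡ m →
    Tr len dist (node i j) ≡ depthSum + excess c (suc (toℕ j))
  Tr-node {m} {c} i j order≡ c+L≡m = +-cancelʳ-≡ (2 * Shared (node i j)) _ _ (begin
    Tr len dist (node i j) + 2 * Shared (node i j)
      ≡⟨ Tr+Shared (node i j) ⟩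
    depthSum + order len * x
      ≡⟨ cong (λ z → depthSum + z * x) (trans order≡ (cong (λ z → suc (2 * z)) (sym c+L≡m))) ⟩
    depthSum + suc (2 * (c + L)) * x
      ≡⟨ regroup depthSum c L x ⟩
    depthSum + 2 * c * x + x * (2 * L + 1)
      ≡⟨ cong (depthSum + 2 * c * x +_) (sym (Shared-node i j)) ⟩
    depthSum + 2 * c * x + (2 * Shared (node i j) + x * x)
      ≡⟨ collect depthSum c x (Shared (node i j)) ⟩
    depthSum + excess c x + 2 * Shared (node i j) ∎)
    where
    open ≡-Reasoning
    x = suc (toℕ j)
    L = len i
    regroup : ∀ S c L x → S + suc (2 * (c + L)) * x ≡ S + 2 * c * x + x * (2 * L + 1)
    regroup = solve-∀
    collect : ∀ S c x M → S + 2 * c * x + (2 * M + x * x) ≡ S + x * (x + 2 * c) + 2 * M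
    collect = solve-∀

-- The unit arithmetic starlike tree T(a, …, a+k)

odd-half : ∀ n → n % 2 ≡ 1 → n ≡ suc (2 * (n / 2))
odd-half n odd = trans (m≡m%n+[m/n]*n n 2) (cong₂ _+_ odd (*-comm (n / 2) 2))

-- The order of T(a, …, a+k) is 1 + Σ_{i≤k} (a + i); written as 2m + 1 this gives
-- the order equation 4m + (k+1) = (k+1)(2a + k + 1).
order-equation : ∀ a k m → order (unitArith a k) ≡ suc (2 * m) →
  2 * (2 * m) + suc k ≡ suc k * (2 * a + suc k)
order-equation a k m order≡ =
  trans (cong (λ z → 2 * z + suc k) 2m≡) (rangeSum-arith a (suc k))
  where
  2m≡ : 2 * m ≡ rangeSum (suc k) (λ y → a + y)
  2m≡ = suc-injective (trans (sym order≡)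
          (trans (StarlikeTree.order-arms (unitArith a k)) (cong suc (sum-tabulate-toℕ (suc k) (a +_)))))

module UnitArithmeticTree (a k m : ℕ) (order≡ : order (unitArith a k) ≡ suc (2 * m))
                          (a+k≤m : a + k ≤ m) where

  open StarlikeTree (unitArith a k)

  slack : Fin (suc k) → ℕ
  slack i = m ∸ (a + toℕ i)

  slack+len : ∀ i → slack i + (a + toℕ i) ≡ m
  slack+len i = m∸n+n≡m (≤-trans (+-monoʳ-≤ a (toℕ≤pred[n] i)) a+k≤m)

  Tr-arm : ∀ i j → Tr (unitArith a k) dist (node i j) ≡ depthSum + excess (slack i) (suc (toℕ j))
  Tr-arm i j = Tr-node {c = slack i} i j order≡ (slack+len i)

  center-below : ∀ i j → Tr (unitArith a k) dist center ≢ Tr (unitArith a k) dist (node i j)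
  center-below i j eq =
    <⇒≢ (m<m+n depthSum (s≤s z≤n)) (trans (sym Tr-center) (trans eq (Tr-arm i j)))

  same-arm : ∀ i j j' → Tr (unitArith a k) dist (node i j) ≡ Tr (unitArith a k) dist (node i j') → j ≡ j'
  same-arm i j j' eq = toℕ-injective (suc-injective (excess-injective (slack i)
    (+-cancelˡ-≡ depthSum _ _ (trans (sym (Tr-arm i j)) (trans eq (Tr-arm i j'))))))

  -- Equal transmissions on arms i < i + δ would force the growth of excess-cross-growth,
  -- which exceeds the budget left by the order equation.
  different-arms : ∀ i j i' j' → toℕ i < toℕ i' →
    Tr (unitArith a k) dist (node i j) ≢ Tr (unitArith a k) dist (node i' j')
  different-arms i j i' j' i<i' eq with m≤n⇒∃[o]m+o≡n i<i'
  ... | o , 1+i+o≡i' = <⇒≱ budget (≤-trans growth (*-monoʳ-≤ (δ ∸ 2) (toℕ<n j)))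
    where
    open ≡-Reasoning
    δ = suc o
    c = slack i'
    L = a + toℕ i
    i+δ≡i' : toℕ i + δ ≡ toℕ i'
    i+δ≡i' = trans (+-suc (toℕ i) o) 1+i+o≡i'
    c+[L+δ]≡m : c + (L + δ) ≡ m
    c+[L+δ]≡m = trans (cong (c +_) (trans (+-assoc a (toℕ i) δ) (cong (a +_) i+δ≡i'))) (slack+len i')
    slack-i : slack i ≡ c + δ
    slack-i = begin
      m ∸ L               ≡⟨ cong (_∸ L) (sym c+[L+δ]≡m) ⟩
      c + (L + δ) ∸ L     ≡⟨ cong (_∸ L) (trans (cong (c +_) (+-comm L δ)) (sym (+-assoc c δ L))) ⟩
      c + δ + L ∸ L       ≡⟨ m+n∸n≡m (c + δ) L ⟩
      c + δ               ∎
    same-excess : excess (c + δ) (suc (toℕ j)) ≡ excess c (suc (toℕ j'))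
    same-excess = +-cancelˡ-≡ depthSum _ _ (begin
      depthSum + excess (c + δ) (suc (toℕ j))   ≡⟨ cong (λ z → depthSum + excess z (suc (toℕ j))) (sym slack-i) ⟩
      depthSum + excess (slack i) (suc (toℕ j)) ≡⟨ sym (Tr-arm i j) ⟩
      Tr (unitArith a k) dist (node i j)         ≡⟨ eq ⟩
      Tr (unitArith a k) dist (node i' j')       ≡⟨ Tr-arm i' j' ⟩
      depthSum + excess c (suc (toℕ j'))         ∎)
    growth : 2 + 2 * c ≤ (δ ∸ 2) * suc (toℕ j)
    growth = excess-cross-growth c δ (suc (toℕ j)) (excess-cross c o (toℕ j) (suc (toℕ j')) same-excess)
    budget : (δ ∸ 2) * L < 2 + 2 * c
    budget = cross-arm-budget a k m (toℕ i) δ c (order-equation a k m order≡) c+[L+δ]≡m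
               (subst (_≤ k) (sym i+δ≡i') (toℕ≤pred[n] i'))

  irregular : TransmissionIrregular (unitArith a k) dist
  irregular center center _ = refl
  irregular center (node i j) eq = contradiction eq (center-below i j)
  irregular (node i j) center eq = contradiction (sym eq) (center-below i j)
  irregular (node i j) (node i' j') eq with <-cmp (toℕ i) (toℕ i')
  ... | tri< i<i' _ _ = contradiction eq (different-arms i j i' j' i<i')
  ... | tri> _ _ i'<i = contradiction (sym eq) (different-arms i' j' i j i'<i)
  ... | tri≈ _ i≡i' _ with toℕ-injective i≡i'
  ...   | refl = cong (node i) (same-arm i j j' eq)

theorem2p2 : (a k : ℕ) → 1 ≤ a → 2 ≤ k → order (unitArith a k) % 2 ≡ 1 →
    ∃ (IsDistance (unitArith a k))
    × (∀ d → IsDistance (unitArith a k) d → TransmissionIrregular (unitArith a k) d)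
theorem2p2 a k 1≤a 2≤k odd =
  (dist , dist-isDistance) , irregular-for-any-distance (UnitArithmeticTree.irregular a k m order≡ a+k≤m)
  where
  open StarlikeTree (unitArith a k)
  m : ℕ
  m = order (unitArith a k) / 2
  order≡ : order (unitArith a k) ≡ suc (2 * m)
  order≡ = odd-half (order (unitArith a k)) odd
  a+k≤m : a + k ≤ m
  a+k≤m = longest-arm-≤-half a k m 1≤a 2≤k (order-equation a k m order≡)
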